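{- Let $H=(V,E)$ be a minimal strict implication hypergraph with vertices $V=\{p_1,\ldots,p_n\}$ and adjacency matrix $A$, and let $\nu,\epsilon>0$. If $H$ is configured, then for all $i\in\{1,\ldots,n\}$, \[ 0\le \sum_{j=1}^n A_{ij}A_{ji}<1. \]
   Context: A directed hypergraph $H=(V,E)$ has vertex set $V$ and hyperedges $e=(T,H)$ with $T,H\subseteq V$; $t(e)=T$ is the tail and $h(e)=H$ the head. An implication hypergraph is a directed hypergraph whose vertices are logical propositions and in which a hyperedge $(T,H)$ represents $\bigwedge_{P\in T}P\implies\bigwedge_{Q\in H}Q$. A vertex $u$ is a descendant of $v$ if it can be reached from $v$ by following hyperedges from tail to head. It is strict if for all $v,w\in V$, $(\{v\},\{w\})\in E$ implies $(\{w\},\{v\})\notin E$. It is minimal if (i) $(\{v\},\{v\})\notin E$ for all $v$; (ii) if $u$ is a descendant of $v$ but not an immediate neighbor of $v$, then $(\{v\},\{u\})\notin E$; (iii) if $(T,H)\in E$ then $(T',H)\notin E$ for every $T'\supsetneq T$. A leaf node is a vertex lying in the tail of no hyperedge; $L(H)$ denotes the set of leaf nodes. The adjacency matrix $A$ is the $n\times n$ matrix with $A_{ij}=\sum_{e\in E,\ p_i\in t(e)}\frac{1}{|t(e)|}\mathbf{1}_{p_j\in h(e)}$. The propositional information $\mathcal{I}_{\nu,\epsilon}(p_i)$ is defined implicitly by the system: $\mathcal{I}_{\nu,\epsilon}(p_i)=\sum_{j=1}^n A_{ij}(\mathcal{I}_{\nu,\epsilon}(p_j)+\epsilon)$ if $p_i\notin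 L(H)$, and $\mathcal{I}_{\nu,\epsilon}(p_i)=\nu$ if $p_i\in L(H)$. $H$ is called configured (for the given $\nu,\epsilon$) if this system has a solution with $\mathcal{I}_{\nu,\epsilon}(p_i)>0$ for all $i\in\{1,\ldots,n\}$.
   Formalization: The parameters ν and ε, and the solution $\mathcal{I}_{\nu,\epsilon}$ whose existence makes H configured, take values in the rationals. -}

module Defs where

open import Data.Nat using (ℕ; zero; suc)
open import Data.Fin using (Fin)
open import Data.Fin.Subset using (Subset; _∈_; _∉_; _⊂_; ⁅_⁆; ∣_∣)
open import Data.Fin.Subset.Properties using (_∈?_)
open import Data.Product using (_×_; _,_; Σ; ∃; proj₁; proj₂)
open import Data.List using (List)
import Data.List.Membership.Propositional as LM
open import Data.List.Relation.Unary.Unique.Propositional using (Unique)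
open import Data.Integer using (+_)
open import Data.Rational using (ℚ; 0ℚ; 1ℚ; _+_; _*_; _/_; _<_; _≤_)
open import Relation.Binary.PropositionalEquality using (_≡_)
open import Relation.Nullary using (¬_; yes; no)

Edge : ℕ → Set
Edge n = Subset n × Subset n

tl : ∀ {n} → Edge n → Subset n
tl = proj₁

hd : ∀ {n} → Edge n → Subset n
hd = proj₂

-- A directed hypergraph on vertices p_1..p_n (= Fin n): a finite SET of
-- hyperedges, represented as a duplicate-free list.
record Hypergraph (n : ℕ) : Set where
  constructor hypergraph
  field
    edges  : List (Edge n)
    unique : Unique edges
open Hypergraph public

_∈E_ : ∀ {n} → Edge n → Hypergraph n → Set
e ∈E G = e LM.∈ edges G

ImmediateNeighbour : ∀ {n} → Hypergraph n → Fin n → Fin n → Set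
ImmediateNeighbour G v u = ∃ λ e → e ∈E G × v ∈ tl e × u ∈ hd e

data Descendant {n} (G : Hypergraph n) (v : Fin n) : Fin n → Set where
  step  : ∀ {u} → ImmediateNeighbour G v u → Descendant G v u
  trans : ∀ {w u} → Descendant G v w → ImmediateNeighbour G w u → Descendant G v u

Strict : ∀ {n} → Hypergraph n → Set
Strict G = ∀ v w → (⁅ v ⁆ , ⁅ w ⁆) ∈E G → ¬ ((⁅ w ⁆ , ⁅ v ⁆) ∈E G)

Minimal : ∀ {n} → Hypergraph n → Set
Minimal G =
  (∀ v → ¬ ((⁅ v ⁆ , ⁅ v ⁆) ∈E G))
  × (∀ v u → Descendant G v u → ¬ ImmediateNeighbour G v u → ¬ ((⁅ v ⁆ , ⁅ u ⁆) ∈E G))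
  × (∀ T H T′ → (T , H) ∈E G → T ⊂ T′ → ¬ ((T′ , H) ∈E G))

Leaf : ∀ {n} → Hypergraph n → Fin n → Set
Leaf G p = ∀ e → e ∈E G → p ∉ tl e

sumL : List ℚ → ℚ
sumL List.[] = 0ℚ
sumL (x List.∷ xs) = x + sumL xs

ΣFin : ∀ n → (Fin n → ℚ) → ℚ
ΣFin zero    f = 0ℚ
ΣFin (suc n) f = f Fin.zero + ΣFin n (λ i → f (Fin.suc i))

-- 1 / k  (only ever used with k = |t(e)| ≥ 1, since p_i ∈ t(e))
inv : ℕ → ℚ
inv zero    = 0ℚ
inv (suc k) = + 1 / suc k

indicator : ∀ {n} → Fin n → Subset n → ℚ
indicator i S with i ∈? S
... | yes _ = 1ℚ
... | no  _ = 0ℚ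

adjEdge : ∀ {n} → Fin n → Fin n → Edge n → ℚ
adjEdge i j e = indicator i (tl e) * inv ∣ tl e ∣ * indicator j (hd e)

Adj : ∀ {n} → Hypergraph n → Fin n → Fin n → ℚ
Adj G i j = sumL (Data.List.map (adjEdge i j) (edges G))

IsInformation : ∀ {n} → Hypergraph n → ℚ → ℚ → (Fin n → ℚ) → Set
IsInformation {n} G ν ε I =
  ∀ i → (Leaf G i → I i ≡ ν)
      × (¬ Leaf G i → I i ≡ ΣFin n (λ j → Adj G i j * (I j + ε)))

Configured : ∀ {n} → Hypergraph n → ℚ → ℚ → Set
Configured {n} G ν ε =
  Σ (Fin n → ℚ) λ I → IsInformation G ν ε I × (∀ i → 0ℚ < I i)

{-# OPTIONS --safe #-}
module Submission where

-- Any nonnegative solution I of the information system satisfies I ≥ A (I + ε)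
-- componentwise: with equality off the leaves, and because leaf rows of A vanish.
-- Reading off a single term gives A_ji (I_i + ε) ≤ I_j, and feeding this back
-- into row i yields (Σ_j A_ij A_ji) (I_i + ε) ≤ Σ_j A_ij (I_j + ε) ≤ I_i < I_i + ε.

open import Defs
open import Data.Nat using (ℕ; zero; suc)
open import Data.Fin using (Fin)
open import Data.Fin.Subset using (_∉_; ∣_∣)
open import Data.Fin.Subset.Properties using (_∈?_)
open import Data.List using ([]; _∷_; map)
open import Data.List.Membership.Propositional using (_∈_)
open import Data.List.Relation.Unary.Any using (here; there)
import Data.List.Relation.Unary.All as All
open import Data.Product using (_×_; _,_; proj₂)
open import Data.Rational using (ℚ; 0ℚ; 1ℚ; _+_; _*_; _<_; _≤_; nonNegative)
open import Data.Rational.Properties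
open import Data.Empty using (⊥-elim)
open import Relation.Nullary using (Dec; yes; no; ¬?)
import Relation.Nullary.Decidable as Dec
open import Relation.Binary.PropositionalEquality using (_≡_; refl; sym; subst)

private
  variable
    n : ℕ

*-pres-nonNeg : ∀ {p q} → 0ℚ ≤ p → 0ℚ ≤ q → 0ℚ ≤ p * q
*-pres-nonNeg {p} {q} 0≤p 0≤q =
  nonNegative⁻¹ _ {{nonNeg*nonNeg⇒nonNeg p {{nonNegative 0≤p}} q {{nonNegative 0≤q}}}}

+-pres-nonNeg : ∀ {p q} → 0ℚ ≤ p → 0ℚ ≤ q → 0ℚ ≤ p + q
+-pres-nonNeg {p} {q} 0≤p 0≤q = subst (_≤ p + q) (+-identityʳ 0ℚ) (+-mono-≤ 0≤p 0≤q)

p≤p+q : ∀ {p q} → 0ℚ ≤ q → p ≤ p + q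
p≤p+q {p} {q} 0≤q = subst (_≤ p + q) (+-identityʳ p) (+-monoʳ-≤ p 0≤q)

p<p+q : ∀ {p q} → 0ℚ < q → p < p + q
p<p+q {p} {q} 0<q = subst (_< p + q) (+-identityʳ p) (+-monoʳ-< p 0<q)

ΣFin-nonNeg : ∀ n {f : Fin n → ℚ} → (∀ k → 0ℚ ≤ f k) → 0ℚ ≤ ΣFin n f
ΣFin-nonNeg zero    f≥0 = ≤-refl
ΣFin-nonNeg (suc n) f≥0 = +-pres-nonNeg (f≥0 Fin.zero) (ΣFin-nonNeg n (λ k → f≥0 (Fin.suc k)))

ΣFin-mono-≤ : ∀ n {f g : Fin n → ℚ} → (∀ k → f k ≤ g k) → ΣFin n f ≤ ΣFin n g
ΣFin-mono-≤ zero    f≤g = ≤-refl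
ΣFin-mono-≤ (suc n) f≤g = +-mono-≤ (f≤g Fin.zero) (ΣFin-mono-≤ n (λ k → f≤g (Fin.suc k)))

ΣFin-zero : ∀ n {f : Fin n → ℚ} → (∀ k → f k ≡ 0ℚ) → ΣFin n f ≡ 0ℚ
ΣFin-zero zero    f≡0 = refl
ΣFin-zero (suc n) f≡0
  rewrite f≡0 Fin.zero | ΣFin-zero n (λ k → f≡0 (Fin.suc k)) = refl

ΣFin-*ʳ : ∀ n (f : Fin n → ℚ) c → ΣFin n (λ k → f k * c) ≡ ΣFin n f * c
ΣFin-*ʳ zero    f c = sym (*-zeroˡ c)
ΣFin-*ʳ (suc n) f c rewrite ΣFin-*ʳ n (λ k → f (Fin.suc k)) c =
  sym (*-distribʳ-+ c (f Fin.zero) _)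

term≤ΣFin : ∀ n {f : Fin n → ℚ} → (∀ k → 0ℚ ≤ f k) → ∀ k → f k ≤ ΣFin n f
term≤ΣFin (suc n) {f} f≥0 Fin.zero =
  p≤p+q (ΣFin-nonNeg n (λ k → f≥0 (Fin.suc k)))
term≤ΣFin (suc n) {f} f≥0 (Fin.suc k) =
  subst (_≤ ΣFin (suc n) f) (+-identityˡ _)
    (+-mono-≤ (f≥0 Fin.zero) (term≤ΣFin n (λ k → f≥0 (Fin.suc k)) k))

Matrix : ℕ → Set
Matrix n = Fin n → Fin n → ℚ

SuperSolution : Matrix n → ℚ → (Fin n → ℚ) → Set
SuperSolution {n} A ε x = ∀ i → ΣFin n (λ j → A i j * (x j + ε)) ≤ x i

module _ {n} (A : Matrix n) (A-nonNeg : ∀ i j → 0ℚ ≤ A i j)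
         {ε : ℚ} {x : Fin n → ℚ} (x-nonNeg : ∀ k → 0ℚ ≤ x k) (0<ε : 0ℚ < ε)
         (super : SuperSolution A ε x) where

  private
    x+ε-nonNeg : ∀ k → 0ℚ ≤ x k + ε
    x+ε-nonNeg k = +-pres-nonNeg (x-nonNeg k) (<⇒≤ 0<ε)

  superSolution-column : ∀ j i → A j i * (x i + ε) ≤ x j
  superSolution-column j i = ≤-trans
    (term≤ΣFin n (λ k → *-pres-nonNeg (A-nonNeg j k) (x+ε-nonNeg k)) i)
    (super j)

  returnSum<1 : ∀ i → ΣFin n (λ j → A i j * A j i) < 1ℚ
  returnSum<1 i = *-cancelʳ-<-nonNeg c {{nonNegative (x+ε-nonNeg i)}} (begin-strict
    ΣFin n (λ j → A i j * A j i) * c     ≡⟨ sym (ΣFin-*ʳ n (λ j → A i j * A j i) c) ⟩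
    ΣFin n (λ j → A i j * A j i * c)     ≤⟨ ΣFin-mono-≤ n returnTerm ⟩
    ΣFin n (λ j → A i j * (x j + ε))     ≤⟨ super i ⟩
    x i                                  <⟨ p<p+q 0<ε ⟩
    c                                    ≡⟨ sym (*-identityˡ c) ⟩
    1ℚ * c                               ∎)
    where
    open ≤-Reasoning
    c : ℚ
    c = x i + ε
    returnTerm : ∀ j → A i j * A j i * c ≤ A i j * (x j + ε)
    returnTerm j = subst (_≤ A i j * (x j + ε)) (sym (*-assoc (A i j) (A j i) c))
      (*-monoˡ-≤-nonNeg (A i j) {{nonNegative (A-nonNeg i j)}}
        (≤-trans (superSolution-column j i) (p≤p+q (<⇒≤ 0<ε))))

indicator-nonNeg : ∀ (i : Fin n) S → 0ℚ ≤ indicator i S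
indicator-nonNeg i S with i ∈? S
... | yes _ = <⇒≤ (positive⁻¹ 1ℚ)
... | no  _ = ≤-refl

indicator-∉ : ∀ (i : Fin n) S → i ∉ S → indicator i S ≡ 0ℚ
indicator-∉ i S i∉S with i ∈? S
... | yes i∈S = ⊥-elim (i∉S i∈S)
... | no  _   = refl

inv-nonNeg : ∀ k → 0ℚ ≤ inv k
inv-nonNeg zero    = ≤-refl
inv-nonNeg (suc k) = nonNegative⁻¹ _ {{normalize-nonNeg 1 (suc k)}}

adjEdge-nonNeg : ∀ (i j : Fin n) e → 0ℚ ≤ adjEdge i j e
adjEdge-nonNeg i j e = *-pres-nonNeg
  (*-pres-nonNeg (indicator-nonNeg i (tl e)) (inv-nonNeg ∣ tl e ∣))
  (indicator-nonNeg j (hd e))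

Adj-nonNeg : ∀ (G : Hypergraph n) i j → 0ℚ ≤ Adj G i j
Adj-nonNeg G i j = go (edges G)
  where
  go : ∀ es → 0ℚ ≤ sumL (map (adjEdge i j) es)
  go []       = ≤-refl
  go (e ∷ es) = +-pres-nonNeg (adjEdge-nonNeg i j e) (go es)

Leaf⇒Adj≡0 : ∀ (G : Hypergraph n) {i} j → Leaf G i → Adj G i j ≡ 0ℚ
Leaf⇒Adj≡0 G {i} j leaf = go (edges G) leaf
  where
  go : ∀ es → (∀ e → e ∈ es → i ∉ tl e) → sumL (map (adjEdge i j) es) ≡ 0ℚ
  go []       _      = refl
  go (e ∷ es) i∉tails
    rewrite indicator-∉ i (tl e) (i∉tails e (here refl))
          | *-zeroˡ (inv ∣ tl e ∣) | *-zeroˡ (indicator j (hd e))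
          | go es (λ e′ e′∈es → i∉tails e′ (there e′∈es)) = refl

leaf? : ∀ (G : Hypergraph n) i → Dec (Leaf G i)
leaf? G i = Dec.map′ (λ all e → All.lookup all) (λ leaf → All.tabulate (leaf _))
  (All.all? (λ e → ¬? (i ∈? tl e)) (edges G))

information⇒superSolution : ∀ (G : Hypergraph n) {ν ε I} → IsInformation G ν ε I →
                            (∀ k → 0ℚ ≤ I k) → SuperSolution (Adj G) ε I
information⇒superSolution {n} G {ε = ε} {I} isInfo I-nonNeg i with leaf? G i
... | yes leaf = subst (_≤ I i) (sym (ΣFin-zero n leafTerm≡0)) (I-nonNeg i)
  where
  leafTerm≡0 : ∀ j → Adj G i j * (I j + ε) ≡ 0ℚ
  leafTerm≡0 j rewrite Leaf⇒Adj≡0 G j leaf = *-zeroˡ (I j + ε)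
... | no ¬leaf = ≤-reflexive (sym (proj₂ (isInfo i) ¬leaf))

theorem1 : ∀ (n : ℕ) (G : Hypergraph n) → Minimal G → Strict G →
    ∀ (ν ε : ℚ) → 0ℚ < ν → 0ℚ < ε → Configured G ν ε →
    ∀ (i : Fin n) → 0ℚ ≤ ΣFin n (λ j → Adj G i j * Adj G j i) × ΣFin n (λ j → Adj G i j * Adj G j i) < 1ℚ
theorem1 n G _ _ _ _ _ 0<ε (I , isInfo , I-pos) i =
  ΣFin-nonNeg n (λ j → *-pres-nonNeg (Adj-nonNeg G i j) (Adj-nonNeg G j i)) ,
  returnSum<1 (Adj G) (Adj-nonNeg G) I-nonNeg 0<ε
    (information⇒superSolution G isInfo I-nonNeg) i
  where
  I-nonNeg : ∀ k → 0ℚ ≤ I k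
  I-nonNeg k = <⇒≤ (I-pos k)
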